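{- Let $p\geq 2$ and let $G$ be a finite simple $\{pK_2, C_4\}$-free graph. Then $\chi(G)\leq f_p(\omega(G))$, where $f_p:\mathbb{N}\to\mathbb{N}$ ($p\geq2$) is defined by: $f_t(1)=1$ for $t\geq 2$; $f_2(s)=s+1$ for $s\geq 2$; $f_p(2)=2p-2$ for $p\geq 3$; and $f_p(m)=\left(\sum_{j=2}^{m} f_{p-1}(j)\right)+1$ for $m,p\geq 3$.
   Context: $\chi(G)$ is the chromatic number and $\omega(G)$ the clique number of $G$. $pK_2$ is the disjoint union of $p$ edges; $C_4$ is the cycle on four vertices. A graph is $\mathcal{F}$-free if it has no induced subgraph isomorphic to a member of $\mathcal{F}$. -}

module Defs where

open import Data.Nat using (ℕ; zero; suc; _+_; _*_; _∸_; _≤_; _≡ᵇ_; _/_)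
open import Data.Bool using (Bool; true; false; _∧_; not)
open import Data.Bool.Properties using (∧-zeroʳ)
open import Data.Fin using (Fin; toℕ; zero; suc)
open import Data.Product using (Σ; _×_)
open import Function.Definitions using (Injective)
open import Relation.Binary.PropositionalEquality using (_≡_; _≢_; refl; cong; cong₂)
open import Relation.Nullary using (¬_)

record Graph (n : ℕ) : Set where
  field
    adj    : Fin n → Fin n → Bool
    sym    : ∀ i j → adj i j ≡ adj j i
    irrefl : ∀ i → adj i i ≡ false
open Graph public

InducedCopy : ∀ {k n} → Graph k → Graph n → Set
InducedCopy {k} {n} H G =
  Σ (Fin k → Fin n) λ φ →
    Injective _≡_ _≡_ φ × (∀ i j → adj G (φ i) (φ j) ≡ adj H i j)

Free : ∀ {k n} → Graph k → Graph n → Set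
Free F G = ¬ InducedCopy F G

private
  ≡ᵇ-sym : ∀ a b → (a ≡ᵇ b) ≡ (b ≡ᵇ a)
  ≡ᵇ-sym zero zero = refl
  ≡ᵇ-sym zero (suc b) = refl
  ≡ᵇ-sym (suc a) zero = refl
  ≡ᵇ-sym (suc a) (suc b) = ≡ᵇ-sym a b

  ≡ᵇ-refl : ∀ a → (a ≡ᵇ a) ≡ true
  ≡ᵇ-refl zero = refl
  ≡ᵇ-refl (suc a) = ≡ᵇ-refl a

-- pK₂: vertices 0..2p-1, with 2a adjacent to 2a+1 (a < p), nothing else.
pK₂ : (p : ℕ) → Graph (2 * p)
pK₂ p = record
  { adj    = A
  ; sym    = λ i j → cong₂ _∧_ (≡ᵇ-sym (toℕ i / 2) (toℕ j / 2))
                               (cong not (≡ᵇ-sym (toℕ i) (toℕ j)))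
  ; irrefl = λ i → irr i
  }
  where
    A : Fin (2 * p) → Fin (2 * p) → Bool
    A i j = (toℕ i / 2 ≡ᵇ toℕ j / 2) ∧ not (toℕ i ≡ᵇ toℕ j)
    irr : ∀ i → A i i ≡ false
    irr i rewrite ≡ᵇ-refl (toℕ i) = ∧-zeroʳ (toℕ i / 2 ≡ᵇ toℕ i / 2)

-- C₄: the cycle 0-1-2-3-0.
private
  c4 : Fin 4 → Fin 4 → Bool
  c4 zero zero = false
  c4 zero (suc zero) = true
  c4 zero (suc (suc zero)) = false
  c4 zero (suc (suc (suc zero))) = true
  c4 (suc zero) zero = true
  c4 (suc zero) (suc zero) = false
  c4 (suc zero) (suc (suc zero)) = true
  c4 (suc zero) (suc (suc (suc zero))) = false
  c4 (suc (suc zero)) zero = false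
  c4 (suc (suc zero)) (suc zero) = true
  c4 (suc (suc zero)) (suc (suc zero)) = false
  c4 (suc (suc zero)) (suc (suc (suc zero))) = true
  c4 (suc (suc (suc zero))) zero = true
  c4 (suc (suc (suc zero))) (suc zero) = false
  c4 (suc (suc (suc zero))) (suc (suc zero)) = true
  c4 (suc (suc (suc zero))) (suc (suc (suc zero))) = false

  c4-sym : ∀ i j → c4 i j ≡ c4 j i
  c4-sym zero zero = refl
  c4-sym zero (suc zero) = refl
  c4-sym zero (suc (suc zero)) = refl
  c4-sym zero (suc (suc (suc zero))) = refl
  c4-sym (suc zero) zero = refl
  c4-sym (suc zero) (suc zero) = refl
  c4-sym (suc zero) (suc (suc zero)) = refl
  c4-sym (suc zero) (suc (suc (suc zero))) = refl
  c4-sym (suc (suc zero)) zero = refl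
  c4-sym (suc (suc zero)) (suc zero) = refl
  c4-sym (suc (suc zero)) (suc (suc zero)) = refl
  c4-sym (suc (suc zero)) (suc (suc (suc zero))) = refl
  c4-sym (suc (suc (suc zero))) zero = refl
  c4-sym (suc (suc (suc zero))) (suc zero) = refl
  c4-sym (suc (suc (suc zero))) (suc (suc zero)) = refl
  c4-sym (suc (suc (suc zero))) (suc (suc (suc zero))) = refl

  c4-irr : ∀ i → c4 i i ≡ false
  c4-irr zero = refl
  c4-irr (suc zero) = refl
  c4-irr (suc (suc zero)) = refl
  c4-irr (suc (suc (suc zero))) = refl

C₄ : Graph 4
C₄ = record { adj = c4 ; sym = c4-sym ; irrefl = c4-irr }

HasClique : ∀ {n} → Graph n → ℕ → Set
HasClique {n} G k =
  Σ (Fin k → Fin n) λ φ →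
    Injective _≡_ _≡_ φ × (∀ i j → i ≢ j → adj G (φ i) (φ j) ≡ true)

IsCliqueNumber : ∀ {n} → Graph n → ℕ → Set
IsCliqueNumber G w = HasClique G w × (∀ k → HasClique G k → k ≤ w)

Colourable : ∀ {n} → Graph n → ℕ → Set
Colourable {n} G c =
  Σ (Fin n → Fin c) λ col → ∀ i j → adj G i j ≡ true → col i ≢ col j

-- f p m = f_p(m) from the paper.  Junk values: f p 0 = 0 (only relevant
-- for the empty graph), and for p < 2 we use m+1 (never used, p ≥ 2).
mutual
  f : ℕ → ℕ → ℕ
  f _ zero = 0
  f _ (suc zero) = 1
  f zero (suc (suc k)) = 3 + k
  f (suc zero) (suc (suc k)) = 3 + k
  f (suc (suc zero)) (suc (suc k)) = 3 + k                    -- f_2(s) = s+1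
  f (suc (suc (suc q))) (suc (suc zero)) = 2 * (3 + q) ∸ 2     -- f_p(2) = 2p-2
  f (suc (suc (suc q))) (suc (suc (suc k))) =
    sumF (suc (suc q)) (suc (suc (suc k))) + 1                  -- Σ_{j=2}^m f_{p-1}(j) + 1

  sumF : ℕ → ℕ → ℕ
  sumF _ zero = 0
  sumF _ (suc zero) = 0
  sumF p (suc (suc k)) = sumF p (suc k) + f p (suc (suc k))

-- Induction on p and on a bound k on the clique number of an induced subgraph P.  If P has no
-- clique of size k, use the bound k - 1 and monotonicity of f; otherwise fix a maximum clique
-- K = κ 0, …, κ (m - 1) and record for every other vertex x the positions firstMiss x < secondMiss x
-- of its first two non-neighbours in K.  C₄-freeness forbids an edge xy with
-- firstMiss x < firstMiss y < secondMiss x, so the vertices missing only one vertex of K are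
-- independent.  For p = 2 the vertices missing two are independent as well, giving m + 1 colours.
-- For p ≥ 3 the vertices with second miss i and first miss j are anticomplete to the edge κ i κ j,
-- hence (p - 1)K₂-free, and complete to the i - 1 other vertices of K before κ i, hence of clique
-- number at most m - i + 1.  By induction they need f (p - 1) (m - i + 1) colours; one palette
-- serves all j for a given i (again by the C₄ argument), and the palettes add up to
-- 1 + Σ_{j=2}^{m} f (p - 1) j colours.

module Submission where

open import Data.Bool using (true; false; if_then_else_; _∧_; not)
import Data.Bool as Bool
open import Data.Bool.Properties using (¬-not)
open import Data.Empty using (⊥; ⊥-elim)
open import Data.Fin using (Fin; toℕ; fromℕ<) renaming (zero to fz; suc to fs)
import Data.Fin
open import Data.Fin.Properties using (any?; toℕ-injective; toℕ<n; toℕ-fromℕ<)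
open import Data.List using (List; []; _∷_; length; take; _++_; lookup)
open import Data.List.Properties using (length-++; length-take)
open import Data.List.Membership.Propositional using (_∈_; _∉_)
open import Data.List.Membership.Propositional.Properties using (∈-lookup)
open import Data.List.Relation.Unary.All as All using (All; []; _∷_; all?)
import Data.List.Relation.Unary.All.Properties as AllP
open import Data.List.Relation.Unary.AllPairs using (AllPairs; []; _∷_; allPairs?)
import Data.List.Relation.Unary.AllPairs.Properties as AllPairs
open import Data.List.Relation.Unary.Any using (here; there)
open import Data.Nat using (ℕ; zero; suc; pred; _+_; _*_; _∸_; _≤_; _<_; z≤n; s≤s; _≟_; _<?_; _≡ᵇ_; _/_)
open import Data.Nat.DivMod using (m/n≡1+[m∸n]/n)
open import Data.Nat.Properties
open import Data.Product using (Σ; _×_; _,_; proj₁; proj₂)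
open import Data.Sum using (_⊎_; inj₁; inj₂; [_,_])
open import Function using (_∘_)
open import Relation.Binary.Definitions using (Symmetric; tri<; tri≈; tri>)
open import Relation.Binary.PropositionalEquality
  using (_≡_; _≢_; ≢-sym; refl; sym; trans; cong; cong₂; subst; module ≡-Reasoning)
open import Relation.Nullary using (¬_; Dec; yes; no; ¬?)
open import Relation.Nullary.Decidable using (_×-dec_)
open import Relation.Unary using (Decidable; U)
open import Relation.Unary.Properties using (U?)
open import Defs hiding (sym)

f-2 : ∀ q → f (3 + q) 2 ≡ 4 + 2 * q
f-2 q = cong (_∸ 2) (*-distribˡ-+ 2 3 q)

2+2q≤f-2 : ∀ q → 2 + 2 * q ≤ f (2 + q) 2
2+2q≤f-2 zero = s≤s (s≤s z≤n)
2+2q≤f-2 (suc q) = ≤-reflexive (trans (cong (2 +_) (*-suc 2 q)) (sym (f-2 q)))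

f-positive : ∀ p k → 0 < f p (suc k)
f-positive _ zero = s≤s z≤n
f-positive zero (suc k) = s≤s z≤n
f-positive (suc zero) (suc k) = s≤s z≤n
f-positive (suc (suc zero)) (suc k) = s≤s z≤n
f-positive (suc (suc (suc q))) (suc zero) = s≤s z≤n
f-positive (suc (suc (suc q))) (suc (suc k)) = m≤n+m 1 _

2≤f : ∀ p {k} → 2 ≤ p → 2 ≤ k → 2 ≤ f p k
2≤f (suc zero) (s≤s ()) _
2≤f (suc (suc zero)) _ (s≤s (s≤s _)) = s≤s (s≤s z≤n)
2≤f (suc (suc (suc q))) {1} _ (s≤s ())
2≤f (suc (suc (suc q))) {2} _ _ = ≤-trans (s≤s (s≤s z≤n)) (2+2q≤f-2 (suc q))
2≤f (suc (suc (suc q))) {suc (suc (suc k))} _ _ =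
  +-monoˡ-≤ 1 (≤-trans (f-positive (2 + q) (2 + k)) (m≤n+m _ _))

f-mono : ∀ p k → 2 ≤ p → f p (suc k) ≤ f p (2 + k)
f-mono (suc zero) k (s≤s ())
f-mono (suc (suc zero)) zero _ = s≤s z≤n
f-mono (suc (suc zero)) (suc k) _ = n≤1+n _
f-mono (suc (suc (suc q))) zero _ = f-positive (3 + q) 1
f-mono (suc (suc (suc q))) (suc zero) _ = begin
  f (3 + q) 2                   ≡⟨ f-2 q ⟩
  2 + (2 + 2 * q)               ≡⟨ +-comm 2 _ ⟩
  (2 + 2 * q) + 2               ≤⟨ +-mono-≤ (2+2q≤f-2 q) (+-monoˡ-≤ 1 (f-positive (2 + q) 2)) ⟩
  f (2 + q) 2 + (f (2 + q) 3 + 1) ≡⟨ +-assoc (f (2 + q) 2) _ 1 ⟨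
  f (3 + q) 3                   ∎
  where open ≤-Reasoning
f-mono (suc (suc (suc q))) (suc (suc k)) _ = +-monoˡ-≤ 1 (m≤m+n _ _)

1+sumF≤f : ∀ q k → 2 ≤ q → suc (sumF q (2 + k)) ≤ f (suc q) (2 + k)
1+sumF≤f (suc zero) k (s≤s ())
1+sumF≤f (suc (suc zero)) zero _ = ≤-refl
1+sumF≤f (suc (suc (suc q))) zero _ = begin
  suc (f (3 + q) 2)   ≡⟨ cong suc (f-2 q) ⟩
  5 + 2 * q           ≤⟨ n≤1+n _ ⟩
  4 + (2 + 2 * q)     ≡⟨ cong (4 +_) (*-suc 2 q) ⟨
  4 + 2 * suc q       ≡⟨ f-2 (suc q) ⟨
  f (4 + q) 2         ∎
  where open ≤-Reasoning
1+sumF≤f (suc (suc q)) (suc k) _ = ≤-reflexive (+-comm 1 _)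

blockStart : (ℕ → ℕ) → ℕ → ℕ
blockStart size zero = 0
blockStart size (suc s) = blockStart size s + size s

module _ (size : ℕ → ℕ) where

  blockStart-mono : ∀ {s t} → s ≤ t → blockStart size s ≤ blockStart size t
  blockStart-mono {t = zero} z≤n = ≤-refl
  blockStart-mono {s} {suc t} s≤1+t with m≤n⇒m<n∨m≡n s≤1+t
  ... | inj₁ (s≤s s≤t) = ≤-trans (blockStart-mono s≤t) (m≤m+n _ _)
  ... | inj₂ refl = ≤-refl

  inBlock-< : ∀ {s t l} → l < size s → s < t → blockStart size s + l < blockStart size t
  inBlock-< {s} l<size s<t = ≤-trans (+-monoʳ-< (blockStart size s) l<size) (blockStart-mono s<t)

  inBlock-injective : ∀ {s s' l l'} → l < size s → l' < size s' →
                      blockStart size s + l ≡ blockStart size s' + l' → s ≡ s' × l ≡ l'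
  inBlock-injective {s} {s'} l<size l'<size eq with <-cmp s s'
  ... | tri< s<s' _ _ = ⊥-elim (<⇒≢ (<-≤-trans (inBlock-< l<size s<s') (m≤m+n _ _)) eq)
  ... | tri> _ _ s'<s = ⊥-elim (<⇒≢ (<-≤-trans (inBlock-< l'<size s'<s) (m≤m+n _ _)) (sym eq))
  ... | tri≈ _ refl _ = refl , +-cancelˡ-≡ (blockStart size s) _ _ eq

blockStart-f : ∀ q {m} → 0 < m → blockStart (λ s → f q (suc s)) m ≡ suc (sumF q m)
blockStart-f q {suc zero} _ = refl
blockStart-f q {suc (suc m)} _ = cong (_+ f q (2 + m)) (blockStart-f q {suc m} (s≤s z≤n))

m∸n≤1+m∸1+n : ∀ m n → m ∸ n ≤ suc (m ∸ suc n)
m∸n≤1+m∸1+n zero zero = z≤n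
m∸n≤1+m∸1+n zero (suc n) = z≤n
m∸n≤1+m∸1+n (suc m) zero = ≤-refl
m∸n≤1+m∸1+n (suc m) (suc n) = m∸n≤1+m∸1+n m n

module _ {A : Set} where

  lookupOr : A → List A → ℕ → A
  lookupOr d [] l = d
  lookupOr d (x ∷ xs) zero = x
  lookupOr d (x ∷ xs) (suc l) = lookupOr d xs l

  All-lookupOr : ∀ {P : A → Set} {d xs l} → All P xs → l < length xs → P (lookupOr d xs l)
  All-lookupOr {l = zero} (px ∷ _) _ = px
  All-lookupOr {l = suc l} (_ ∷ pxs) (s≤s l<n) = All-lookupOr pxs l<n

  AllPairs-lookupOr : ∀ {R : A → A → Set} → Symmetric R → ∀ {d xs l l'} → AllPairs R xs →
                      l < length xs → l' < length xs → l ≢ l' → R (lookupOr d xs l) (lookupOr d xs l')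
  AllPairs-lookupOr R-sym {l = zero} {zero} _ _ _ l≢l' = ⊥-elim (l≢l' refl)
  AllPairs-lookupOr R-sym {l = zero} {suc l'} (px ∷ _) _ (s≤s l'<n) _ = All-lookupOr px l'<n
  AllPairs-lookupOr R-sym {l = suc l} {zero} (px ∷ _) (s≤s l<n) _ _ = R-sym (All-lookupOr px l<n)
  AllPairs-lookupOr R-sym {l = suc l} {suc l'} (_ ∷ pxs) (s≤s l<n) (s≤s l'<n) l≢l' =
    AllPairs-lookupOr R-sym pxs l<n l'<n (λ eq → l≢l' (cong suc eq))

  lookupOr-∈ : ∀ {d xs l} → l < length xs → lookupOr d xs l ∈ xs
  lookupOr-∈ {xs = x ∷ xs} {zero} _ = here refl
  lookupOr-∈ {xs = x ∷ xs} {suc l} (s≤s l<n) = there (lookupOr-∈ l<n)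

  ∈⇒lookupOr : ∀ {d x xs} → x ∈ xs → Σ ℕ λ l → l < length xs × lookupOr d xs l ≡ x
  ∈⇒lookupOr (here refl) = 0 , s≤s z≤n , refl
  ∈⇒lookupOr (there x∈xs) with ∈⇒lookupOr x∈xs
  ... | l , l<n , eq = suc l , s≤s l<n , eq

  prefixWithout : ℕ → ℕ → List A → List A
  prefixWithout zero j xs = []
  prefixWithout (suc i) j [] = []
  prefixWithout (suc i) zero (x ∷ xs) = take i xs
  prefixWithout (suc i) (suc j) (x ∷ xs) = x ∷ prefixWithout i j xs

  All-prefixWithout : ∀ {P : A → Set} i j {xs} → All P xs → All P (prefixWithout i j xs)
  All-prefixWithout zero j _ = []
  All-prefixWithout (suc i) j [] = []
  All-prefixWithout (suc i) zero (_ ∷ pxs) = AllP.take⁺ i pxs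
  All-prefixWithout (suc i) (suc j) (px ∷ pxs) = px ∷ All-prefixWithout i j pxs

  AllPairs-prefixWithout : ∀ {R : A → A → Set} i j {xs} → AllPairs R xs → AllPairs R (prefixWithout i j xs)
  AllPairs-prefixWithout zero j _ = []
  AllPairs-prefixWithout (suc i) j [] = []
  AllPairs-prefixWithout (suc i) zero (_ ∷ pxs) = AllPairs.take⁺ i pxs
  AllPairs-prefixWithout (suc i) (suc j) (px ∷ pxs) =
    All-prefixWithout i j px ∷ AllPairs-prefixWithout i j pxs

  length-prefixWithout : ∀ {i j} xs → j < i → i ≤ length xs → suc (length (prefixWithout i j xs)) ≡ i
  length-prefixWithout {suc i} {zero} (x ∷ xs) _ (s≤s i≤n) =
    cong suc (trans (length-take i xs) (m≤n⇒m⊓n≡m i≤n))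
  length-prefixWithout {suc i} {suc j} (x ∷ xs) (s≤s j<i) (s≤s i≤n) =
    cong suc (length-prefixWithout xs j<i i≤n)

ofLength? : ∀ {n} (Q : List (Fin n) → Set) → Decidable Q → ∀ k →
            Dec (Σ (List (Fin n)) λ xs → length xs ≡ k × Q xs)
ofLength? Q Q? zero with Q? []
... | yes q = yes ([] , refl , q)
... | no ¬q = no λ { ([] , refl , q) → ¬q q }
ofLength? Q Q? (suc k) with any? (λ x → ofLength? (λ ys → Q (x ∷ ys)) (λ ys → Q? (x ∷ ys)) k)
... | yes (x , ys , refl , q) = yes (x ∷ ys , refl , q)
... | no ¬q = no λ { (x ∷ ys , refl , q) → ¬q (x , ys , refl , q) }

module _ {n : ℕ} (G : Graph n) where

  open import Data.List.Membership.DecPropositional (Data.Fin._≟_ {n}) using (_∈?_)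

  Adj NonAdj : Fin n → Fin n → Set
  Adj x y = adj G x y ≡ true
  NonAdj x y = adj G x y ≡ false

  Adj-sym : ∀ {x y} → Adj x y → Adj y x
  Adj-sym {x} {y} = trans (Graph.sym G y x)

  NonAdj-sym : ∀ {x y} → NonAdj x y → NonAdj y x
  NonAdj-sym {x} {y} = trans (Graph.sym G y x)

  Adj⇒≢ : ∀ {x y} → Adj x y → x ≢ y
  Adj⇒≢ {x} x~x refl with trans (sym x~x) (irrefl G x)
  ... | ()

  Adj⇒¬NonAdj : ∀ {x y} → Adj x y → ¬ NonAdj x y
  Adj⇒¬NonAdj x~y x≁y with trans (sym x~y) x≁y
  ... | ()

  ¬Adj⇒NonAdj : ∀ {x y} → ¬ Adj x y → NonAdj x y
  ¬Adj⇒NonAdj = ¬-not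

  adj? : ∀ x y → Dec (Adj x y)
  adj? x y = adj G x y Bool.≟ true

  VertexSet : Set₁
  VertexSet = Fin n → Set

  IsClique : VertexSet → List (Fin n) → Set
  IsClique P xs = AllPairs Adj xs × All P xs

  CliqueBound : VertexSet → ℕ → Set
  CliqueBound P k = ∀ xs → IsClique P xs → length xs ≤ k

  Edge : Set
  Edge = Fin n × Fin n

  IsEdgeOf : VertexSet → Edge → Set
  IsEdgeOf P (x , y) = Adj x y × P x × P y

  Anticomplete : Edge → Edge → Set
  Anticomplete (x , y) (u , v) = NonAdj x u × NonAdj x v × NonAdj y u × NonAdj y v

  IsInducedMatching : VertexSet → List Edge → Set
  IsInducedMatching P es = All (IsEdgeOf P) es × AllPairs Anticomplete es

  InducedMatchingFree : ℕ → VertexSet → Set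
  InducedMatchingFree q P = ∀ es → IsInducedMatching P es → length es ≢ q

  Colouring : VertexSet → ℕ → Set
  Colouring P c = Σ (Fin n → ℕ) λ col →
    (∀ x → P x → col x < c) × (∀ x y → P x → P y → Adj x y → col x ≢ col y)

  C₄Free : Set
  C₄Free = ∀ a b c d → Adj a b → Adj b c → Adj c d → Adj d a →
           NonAdj a c → NonAdj b d → a ≢ c → b ≢ d → ⊥

  colouring-mono : ∀ {P c c'} → c ≤ c' → Colouring P c → Colouring P c'
  colouring-mono c≤c' (col , col< , proper) = col , (λ x Px → <-≤-trans (col< x Px) c≤c') , proper

  cliqueBound0⇒colouring0 : ∀ {P} → CliqueBound P 0 → Colouring P 0
  cliqueBound0⇒colouring0 {P} bound = (λ _ → 0) , (λ x → ⊥-elim ∘ empty x) , λ x _ Px _ _ _ → empty x Px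
    where
      empty : ∀ x → ¬ P x
      empty x Px = 1+n≰n (bound (x ∷ []) ([] ∷ [] , Px ∷ []))

  cliqueBound1⇒colouring1 : ∀ {P} → CliqueBound P 1 → Colouring P 1
  cliqueBound1⇒colouring1 bound =
    (λ _ → 0) , (λ _ _ → s≤s z≤n) ,
    λ x y Px Py x~y _ → 1+n≰n (bound (x ∷ y ∷ []) (((x~y ∷ []) ∷ [] ∷ []) , Px ∷ Py ∷ []))

  colouring-by-blocks : ∀ {P} (size : ℕ → ℕ) B (block local : Fin n → ℕ) →
    (∀ x → P x → block x < B) → (∀ x → P x → local x < size (block x)) →
    (∀ x y → P x → P y → Adj x y → block x ≡ block y → local x ≢ local y) →
    Colouring P (blockStart size B)
  colouring-by-blocks size B block local block<B local<size separated =
    (λ x → blockStart size (block x) + local x) ,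
    (λ x Px → inBlock-< size (local<size x Px) (block<B x Px)) ,
    λ x y Px Py x~y eq →
      let same-block , same-local = inBlock-injective size (local<size x Px) (local<size y Py) eq
      in separated x y Px Py x~y same-block same-local

  cliqueBound-join : ∀ {P Q : VertexSet} {m S} → CliqueBound P m → IsClique P S →
                     (∀ {u} → Q u → P u × All (Adj u) S) → CliqueBound Q (m ∸ length S)
  cliqueBound-join {S = S} bound (S-pairs , S⊆P) joined xs (xs-pairs , xs⊆Q) =
    m+n≤o⇒m≤o∸n (length xs) (subst (_≤ _) (length-++ xs) (bound (xs ++ S)
      ( AllPairs.++⁺ xs-pairs S-pairs (All.map (proj₂ ∘ joined) xs⊆Q)
      , AllP.++⁺ (All.map (proj₁ ∘ joined) xs⊆Q) S⊆P)))

  inducedMatchingFree-anticomplete :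
    ∀ {P Q : VertexSet} {q} → 0 < q → (a b : Fin n) →
    (∀ {u} → Q u → P u × IsEdgeOf P (a , b) × NonAdj a u × NonAdj b u) →
    InducedMatchingFree (suc q) P → InducedMatchingFree q Q
  inducedMatchingFree-anticomplete q>0 a b _ _ [] _ refl = <⇒≢ q>0 refl
  inducedMatchingFree-anticomplete {P} {Q} q>0 a b joined noMatching (e ∷ es) (edges , anti) len =
    noMatching ((a , b) ∷ e ∷ es)
      (ab-edge ∷ All.map weaken edges , All.map anticomplete edges ∷ anti) (cong suc len)
    where
      ab-edge : IsEdgeOf P (a , b)
      ab-edge = proj₁ (proj₂ (joined (proj₁ (proj₂ (All.head edges)))))
      weaken : ∀ {e} → IsEdgeOf Q e → IsEdgeOf P e
      weaken (u~v , Qu , Qv) = u~v , proj₁ (joined Qu) , proj₁ (joined Qv)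
      anticomplete : ∀ {e} → IsEdgeOf Q e → Anticomplete (a , b) e
      anticomplete (_ , Qu , Qv) =
        let _ , _ , a≁u , b≁u = joined Qu ; _ , _ , a≁v , b≁v = joined Qv
        in a≁u , a≁v , b≁u , b≁v

  module _ {P : VertexSet} (P? : Decidable P) where

    cliqueBound-attained : ∀ {k} → CliqueBound P (suc k) →
      CliqueBound P k ⊎ Σ (List (Fin n)) λ K → length K ≡ suc k × IsClique P K
    cliqueBound-attained {k} bound
      with ofLength? (IsClique P) (λ xs → allPairs? adj? xs ×-dec all? P? xs) (suc k)
    ... | yes K = inj₂ K
    ... | no ¬K = inj₁ λ xs xs-clique →
      ≤-pred (≤∧≢⇒< (bound xs xs-clique) (λ len → ¬K (xs , len , xs-clique)))

  -- The index in K of the first (second) non-neighbour of x, or length K if there is none.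
  firstMiss secondMiss : Fin n → List (Fin n) → ℕ
  firstMiss x [] = 0
  firstMiss x (w ∷ K) = if adj G x w then suc (firstMiss x K) else 0
  secondMiss x [] = 0
  secondMiss x (w ∷ K) = if adj G x w then suc (secondMiss x K) else suc (firstMiss x K)

  profileClique : Fin n → List (Fin n) → List (Fin n)
  profileClique x K = prefixWithout (secondMiss x K) (firstMiss x K) K

  firstMiss≤secondMiss : ∀ x K → firstMiss x K ≤ secondMiss x K
  firstMiss≤secondMiss x [] = z≤n
  firstMiss≤secondMiss x (w ∷ K) with adj G x w
  ... | true = s≤s (firstMiss≤secondMiss x K)
  ... | false = z≤n

  firstMiss<secondMiss : ∀ x K → firstMiss x K < length K → firstMiss x K < secondMiss x K
  firstMiss<secondMiss x (w ∷ K) f<n with adj G x w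
  ... | true = s≤s (firstMiss<secondMiss x K (≤-pred f<n))
  ... | false = s≤s z≤n

  secondMiss≤length : ∀ x K → secondMiss x K ≤ length K
  secondMiss≤length x [] = z≤n
  secondMiss≤length x (w ∷ K) with adj G x w
  ... | true = s≤s (secondMiss≤length x K)
  ... | false = s≤s (≤-trans (firstMiss≤secondMiss x K) (secondMiss≤length x K))

  firstMiss≡length⇒All-Adj : ∀ x K → firstMiss x K ≡ length K → All (Adj x) K
  firstMiss≡length⇒All-Adj x [] _ = []
  firstMiss≡length⇒All-Adj x (w ∷ K) f≡n with adj G x w in x~w
  ... | true = x~w ∷ firstMiss≡length⇒All-Adj x K (suc-injective f≡n)

  All-Adj-take-firstMiss : ∀ x K → All (Adj x) (take (firstMiss x K) K)
  All-Adj-take-firstMiss x [] = []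
  All-Adj-take-firstMiss x (w ∷ K) with adj G x w in x~w
  ... | true = x~w ∷ All-Adj-take-firstMiss x K
  ... | false = []

  All-Adj-profileClique : ∀ x K → All (Adj x) (profileClique x K)
  All-Adj-profileClique x [] = []
  All-Adj-profileClique x (w ∷ K) with adj G x w in x~w
  ... | true = x~w ∷ All-Adj-profileClique x K
  ... | false = All-Adj-take-firstMiss x K

  IsClique-profileClique : ∀ {P} x {K} → IsClique P K → IsClique P (profileClique x K)
  IsClique-profileClique x {K} (K-pairs , K⊆P) =
    AllPairs-prefixWithout (secondMiss x K) (firstMiss x K) K-pairs ,
    All-prefixWithout (secondMiss x K) (firstMiss x K) K⊆P

  length-profileClique : ∀ x K → firstMiss x K < length K →
                         suc (length (profileClique x K)) ≡ secondMiss x K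
  length-profileClique x K f<n =
    length-prefixWithout K (firstMiss<secondMiss x K f<n) (secondMiss≤length x K)

  module _ (d : Fin n) where

    Adj-before-firstMiss : ∀ x K {l} → l < firstMiss x K → Adj x (lookupOr d K l)
    Adj-before-firstMiss x (w ∷ K) {l} l<f with adj G x w in x~w
    Adj-before-firstMiss x (w ∷ K) {zero} _ | true = x~w
    Adj-before-firstMiss x (w ∷ K) {suc l} (s≤s l<f) | true = Adj-before-firstMiss x K l<f

    NonAdj-firstMiss : ∀ x K → firstMiss x K < length K → NonAdj x (lookupOr d K (firstMiss x K))
    NonAdj-firstMiss x (w ∷ K) f<n with adj G x w in x~w
    ... | true = NonAdj-firstMiss x K (≤-pred f<n)
    ... | false = x~w

    NonAdj-secondMiss : ∀ x K → secondMiss x K < length K → NonAdj x (lookupOr d K (secondMiss x K))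
    NonAdj-secondMiss x (w ∷ K) s<n with adj G x w in x~w
    ... | true = NonAdj-secondMiss x K (≤-pred s<n)
    ... | false = NonAdj-firstMiss x K (≤-pred s<n)

    Adj-before-secondMiss : ∀ x K {l} → l < secondMiss x K → l ≢ firstMiss x K → Adj x (lookupOr d K l)
    Adj-before-secondMiss x (w ∷ K) {l} l<s l≢f with adj G x w in x~w
    Adj-before-secondMiss x (w ∷ K) {zero} _ _ | true = x~w
    Adj-before-secondMiss x (w ∷ K) {suc l} (s≤s l<s) l≢f | true =
      Adj-before-secondMiss x K l<s (l≢f ∘ cong suc)
    Adj-before-secondMiss x (w ∷ K) {zero} _ l≢f | false = ⊥-elim (l≢f refl)
    Adj-before-secondMiss x (w ∷ K) {suc l} (s≤s l<f) _ | false = Adj-before-firstMiss x K l<f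

  module MaximumClique (c4-free : C₄Free) {P : VertexSet} (K : List (Fin n)) (d : Fin n)
                       (K-clique : IsClique P K) (K-maximum : CliqueBound P (length K)) where

    m : ℕ
    m = length K

    κ : ℕ → Fin n
    κ = lookupOr d K

    κ∈P : ∀ {l} → l < m → P (κ l)
    κ∈P = All-lookupOr (proj₂ K-clique)

    κ-adj : ∀ {l l'} → l < m → l' < m → l ≢ l' → Adj (κ l) (κ l')
    κ-adj = AllPairs-lookupOr Adj-sym (proj₁ K-clique)

    ∉K⇒≢κ : ∀ {x l} → x ∉ K → l < m → x ≢ κ l
    ∉K⇒≢κ x∉K l<m refl = x∉K (lookupOr-∈ l<m)

    firstMiss<m : ∀ {x} → P x → x ∉ K → firstMiss x K < m
    firstMiss<m {x} Px x∉K = ≤∧≢⇒< (≤-trans (firstMiss≤secondMiss x K) (secondMiss≤length x K))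
      λ f≡m → 1+n≰n (K-maximum (x ∷ K)
        (firstMiss≡length⇒All-Adj x K f≡m ∷ proj₁ K-clique , Px ∷ proj₂ K-clique))

    secondMiss<m⇒firstMiss<m : ∀ {x} → secondMiss x K < m → firstMiss x K < m
    secondMiss<m⇒firstMiss<m {x} = ≤-<-trans (firstMiss≤secondMiss x K)

    -- Otherwise x y κ (firstMiss x) κ (firstMiss y) would be an induced C₄.
    crossing-misses : ∀ {x y} → P x → P y → x ∉ K → y ∉ K → Adj x y →
                      firstMiss x K < firstMiss y K → firstMiss y K < secondMiss x K → ⊥
    crossing-misses {x} {y} Px Py x∉K y∉K x~y fx<fy fy<sx =
      c4-free x y (κ (firstMiss x K)) (κ (firstMiss y K)) x~y
        (Adj-before-firstMiss d y K fx<fy)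
        (κ-adj fx<m fy<m (<⇒≢ fx<fy))
        (Adj-sym (Adj-before-secondMiss d x K fy<sx (≢-sym (<⇒≢ fx<fy))))
        (NonAdj-firstMiss d x K fx<m) (NonAdj-firstMiss d y K fy<m)
        (∉K⇒≢κ x∉K fx<m) (∉K⇒≢κ y∉K fy<m)
      where
        fx<m = firstMiss<m Px x∉K
        fy<m = firstMiss<m Py y∉K

    sameSecondMiss⇒sameFirstMiss : ∀ {x y} → P x → P y → x ∉ K → y ∉ K → Adj x y →
      secondMiss x K ≡ secondMiss y K → firstMiss x K ≡ firstMiss y K
    sameSecondMiss⇒sameFirstMiss {x} {y} Px Py x∉K y∉K x~y sx≡sy
      with <-cmp (firstMiss x K) (firstMiss y K)
    ... | tri< fx<fy _ _ = ⊥-elim (crossing-misses Px Py x∉K y∉K x~y fx<fy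
          (<-≤-trans (firstMiss<secondMiss y K (firstMiss<m Py y∉K)) (≤-reflexive (sym sx≡sy))))
    ... | tri≈ _ fx≡fy _ = fx≡fy
    ... | tri> _ _ fy<fx = ⊥-elim (crossing-misses Py Px y∉K x∉K (Adj-sym x~y) fy<fx
          (<-≤-trans (firstMiss<secondMiss x K (firstMiss<m Px x∉K)) (≤-reflexive sx≡sy)))

    -- Adjacent such vertices miss the same vertex of K, and replacing it by both enlarges K.
    oneMiss-independent : ∀ {x y} → P x → P y → x ∉ K → y ∉ K →
                          m ≤ secondMiss x K → m ≤ secondMiss y K → ¬ Adj x y
    oneMiss-independent {x} {y} Px Py x∉K y∉K m≤sx m≤sy x~y =
      1+n≰n (≤-trans (≤-reflexive |x∷y∷S|) (K-maximum (x ∷ y ∷ S)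
        (((x~y ∷ All-Adj-profileClique x K) ∷ y~S ∷ proj₁ S-clique) , Px ∷ Py ∷ proj₂ S-clique)))
      where
        S = profileClique x K
        S-clique = IsClique-profileClique x K-clique
        sx≡m = ≤-antisym (secondMiss≤length x K) m≤sx
        sy≡m = ≤-antisym (secondMiss≤length y K) m≤sy
        y~S : All (Adj y) S
        y~S = subst (All (Adj y))
          (cong₂ (λ i j → prefixWithout i j K) (trans sy≡m (sym sx≡m))
            (sym (sameSecondMiss⇒sameFirstMiss Px Py x∉K y∉K x~y (trans sx≡m (sym sy≡m)))))
          (All-Adj-profileClique y K)
        |x∷y∷S| : suc m ≡ length (x ∷ y ∷ S)
        |x∷y∷S| = cong suc (sym (trans (length-profileClique x K (firstMiss<m Px x∉K)) sx≡m))

    data Kind (x : Fin n) : Set where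
      member    : ∀ t → t < m → κ t ≡ x → Kind x
      twoMisses : x ∉ K → secondMiss x K < m → Kind x
      oneMiss   : x ∉ K → m ≤ secondMiss x K → Kind x

    kind : ∀ x → Kind x
    kind x with x ∈? K | secondMiss x K <? m
    ... | yes x∈K | _ = let t , t<m , κt≡x = ∈⇒lookupOr x∈K in member t t<m κt≡x
    ... | no x∉K | yes s<m = twoMisses x∉K s<m
    ... | no x∉K | no s≮m = oneMiss x∉K (≮⇒≥ s≮m)

    member-oneMiss-nonadjacent : ∀ {x y t} → κ t ≡ x → P y → y ∉ K → ¬ (Adj x y × t ≡ firstMiss y K)
    member-oneMiss-nonadjacent {y = y} refl Py y∉K (x~y , refl) =
      Adj⇒¬NonAdj (Adj-sym x~y) (NonAdj-firstMiss d y K (firstMiss<m Py y∉K))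

    module TwoMatchingFree (2K₂-free : InducedMatchingFree 2 P) where

      -- If y missed both, x y and κ (firstMiss x) κ (secondMiss x) would be an induced 2K₂.
      reaches-miss : ∀ {x y} → P x → P y → secondMiss x K < m → Adj x y →
                     Σ ℕ λ c → c < m × Adj y (κ c) × NonAdj x (κ c)
      reaches-miss {x} {y} Px Py sx<m x~y = reaches (adj? y (κ fx)) (adj? y (κ sx))
        where
          fx = firstMiss x K
          sx = secondMiss x K
          fx<m = secondMiss<m⇒firstMiss<m sx<m
          x≁fx = NonAdj-firstMiss d x K fx<m
          x≁sx = NonAdj-secondMiss d x K sx<m
          fx~sx = κ-adj fx<m sx<m (<⇒≢ (firstMiss<secondMiss x K fx<m))
          reaches : Dec (Adj y (κ fx)) → Dec (Adj y (κ sx)) → Σ ℕ λ c → c < m × Adj y (κ c) × NonAdj x (κ c)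
          reaches (yes y~fx) _ = fx , fx<m , y~fx , x≁fx
          reaches (no _) (yes y~sx) = sx , sx<m , y~sx , x≁sx
          reaches (no y≁fx) (no y≁sx) = ⊥-elim (2K₂-free ((x , y) ∷ (κ fx , κ sx) ∷ [])
            ( (x~y , Px , Py) ∷ (fx~sx , κ∈P fx<m , κ∈P sx<m) ∷ []
            , ((x≁fx , x≁sx , ¬Adj⇒NonAdj y≁fx , ¬Adj⇒NonAdj y≁sx) ∷ []) ∷ [] ∷ [])
            refl)

      twoMisses-independent : ∀ {x y} → P x → P y → x ∉ K → y ∉ K →
                              secondMiss x K < m → secondMiss y K < m → ¬ Adj x y
      twoMisses-independent Px Py x∉K y∉K sx<m sy<m x~y
        with reaches-miss Px Py sx<m x~y | reaches-miss Py Px sy<m (Adj-sym x~y)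
      ... | c , c<m , y~c , x≁c | c' , c'<m , x~c' , y≁c' =
        c4-free _ _ (κ c) (κ c') x~y y~c (κ-adj c<m c'<m c≢c') (Adj-sym x~c') x≁c y≁c'
          (∉K⇒≢κ x∉K c<m) (∉K⇒≢κ y∉K c'<m)
        where
          c≢c' : c ≢ c'
          c≢c' refl = Adj⇒¬NonAdj x~c' x≁c

      colour : ∀ x → Kind x → ℕ
      colour x (member t _ _) = t
      colour x (twoMisses _ _) = m
      colour x (oneMiss _ _) = firstMiss x K

      colour<1+m : ∀ x (k : Kind x) → P x → colour x k < suc m
      colour<1+m x (member t t<m _) _ = m≤n⇒m≤1+n t<m
      colour<1+m x (twoMisses _ _) _ = ≤-refl
      colour<1+m x (oneMiss x∉K _) Px = m≤n⇒m≤1+n (firstMiss<m Px x∉K)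

      colour-proper : ∀ x y (kx : Kind x) (ky : Kind y) → P x → P y → Adj x y → colour x kx ≢ colour y ky
      colour-proper x y (member _ _ refl) (member _ _ refl) _ _ x~y t≡t' = Adj⇒≢ x~y (cong κ t≡t')
      colour-proper x y (member t t<m _) (twoMisses _ _) _ _ _ = <⇒≢ t<m
      colour-proper x y (member t _ κt≡x) (oneMiss y∉K _) _ Py x~y t≡fy =
        member-oneMiss-nonadjacent κt≡x Py y∉K (x~y , t≡fy)
      colour-proper x y (twoMisses _ _) (member t t<m _) _ _ _ = <⇒≢ t<m ∘ sym
      colour-proper x y (twoMisses x∉K sx<m) (twoMisses y∉K sy<m) Px Py x~y _ =
        twoMisses-independent Px Py x∉K y∉K sx<m sy<m x~y
      colour-proper x y (twoMisses _ _) (oneMiss y∉K _) _ Py _ = <⇒≢ (firstMiss<m Py y∉K) ∘ sym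
      colour-proper x y (oneMiss x∉K _) (member t _ κt≡y) Px _ x~y fx≡t =
        member-oneMiss-nonadjacent κt≡y Px x∉K (Adj-sym x~y , sym fx≡t)
      colour-proper x y (oneMiss x∉K _) (twoMisses _ _) Px _ _ = <⇒≢ (firstMiss<m Px x∉K)
      colour-proper x y (oneMiss x∉K m≤sx) (oneMiss y∉K m≤sy) Px Py x~y _ =
        oneMiss-independent Px Py x∉K y∉K m≤sx m≤sy x~y

      colouring : Colouring P (suc m)
      colouring = (λ x → colour x (kind x)) , (λ x → colour<1+m x (kind x)) ,
                  λ x y → colour-proper x y (kind x) (kind y)

    module Layered (P? : Decidable P) (2≤m : 2 ≤ m) (q : ℕ) (2≤q : 2 ≤ q)
                   (χ-bound-q : ∀ k {Q} → Decidable Q → InducedMatchingFree q Q → CliqueBound Q k →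
                                Colouring Q (f q k))
                   (matchingFree : InducedMatchingFree (suc q) P) where

      ProfileClass : ℕ → ℕ → VertexSet
      ProfileClass i j x = P x × x ∉ K × firstMiss x K ≡ j × secondMiss x K ≡ i × i < m

      profileClass? : ∀ i j → Decidable (ProfileClass i j)
      profileClass? i j x =
        P? x ×-dec ¬? (x ∈? K) ×-dec firstMiss x K ≟ j ×-dec secondMiss x K ≟ i ×-dec i <? m

      profileClass-anticomplete : ∀ {i j u} → ProfileClass i j u →
        P u × IsEdgeOf P (κ i , κ j) × NonAdj (κ i) u × NonAdj (κ j) u
      profileClass-anticomplete {u = u} (Pu , u∉K , refl , refl , su<m) =
        Pu , (κ-adj su<m fu<m (≢-sym (<⇒≢ fu<su)) , κ∈P su<m , κ∈P fu<m) ,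
        NonAdj-sym (NonAdj-secondMiss d u K su<m) , NonAdj-sym (NonAdj-firstMiss d u K fu<m)
        where
          fu<m = firstMiss<m Pu u∉K
          fu<su = firstMiss<secondMiss u K fu<m

      profileClass-matchingFree : ∀ i j → InducedMatchingFree q (ProfileClass i j)
      profileClass-matchingFree i j =
        inducedMatchingFree-anticomplete (<⇒≤ 2≤q) (κ i) (κ j) profileClass-anticomplete matchingFree

      -- A class is joined to the profile clique of any of its members, of size i - 1.
      profileClass-cliqueBound : ∀ i j → CliqueBound (ProfileClass i j) (suc (m ∸ i))
      profileClass-cliqueBound i j [] _ = z≤n
      profileClass-cliqueBound i j (x ∷ xs) xs-clique@(_ , (Px , x∉K , refl , refl , _) ∷ _) =
        ≤-trans (cliqueBound-join K-maximum (IsClique-profileClique x K-clique) joined (x ∷ xs) xs-clique)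
          (subst (λ s → m ∸ length S ≤ suc (m ∸ s)) (length-profileClique x K (firstMiss<m Px x∉K))
            (m∸n≤1+m∸1+n m (length S)))
        where
          S = profileClique x K
          joined : ∀ {u} → ProfileClass (secondMiss x K) (firstMiss x K) u → P u × All (Adj u) S
          joined {u} (Pu , _ , fu≡fx , su≡sx , _) =
            Pu , subst (All (Adj u)) (cong₂ (λ i j → prefixWithout i j K) su≡sx fu≡fx)
                   (All-Adj-profileClique u K)

      classColouring : ∀ i j → Colouring (ProfileClass i j) (f q (suc (m ∸ i)))
      classColouring i j = χ-bound-q (suc (m ∸ i)) (profileClass? i j)
        (profileClass-matchingFree i j) (profileClass-cliqueBound i j)

      -- Block m − i holds the vertices with second miss i, together with κ i, which misses them
      -- all; κ 0 joins κ 1 in block m − 1, whose vertices all miss κ 0 first.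
      block : ∀ x → Kind x → ℕ
      block x (member t _ _) = m ∸ suc (pred t)
      block x (twoMisses _ _) = m ∸ secondMiss x K
      block x (oneMiss _ _) = 0

      local : ∀ x → Kind x → ℕ
      local x (member zero _ _) = 1
      local x (member (suc t) _ _) = 0
      local x (twoMisses _ _) = proj₁ (classColouring (secondMiss x K) (firstMiss x K)) x
      local x (oneMiss _ _) = 0

      size : ℕ → ℕ
      size s = f q (suc s)

      1+pred<m : ∀ {t} → t < m → suc (pred t) < m
      1+pred<m {zero} _ = 2≤m
      1+pred<m {suc t} t<m = t<m

      block<m : ∀ x (k : Kind x) → block x k < m
      block<m x (member t t<m _) = ∸-monoʳ-< (s≤s z≤n) (<⇒≤ (1+pred<m t<m))
      block<m x (twoMisses x∉K sx<m) =
        ∸-monoʳ-< (≤-<-trans z≤n (firstMiss<secondMiss x K (secondMiss<m⇒firstMiss<m sx<m))) (<⇒≤ sx<m)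
      block<m x (oneMiss _ _) = <-≤-trans (s≤s z≤n) 2≤m

      local<size : ∀ x (k : Kind x) → P x → local x k < size (block x k)
      local<size x (member zero _ _) _ = 2≤f q 2≤q (s≤s (∸-monoˡ-≤ 1 2≤m))
      local<size x (member (suc t) _ _) _ = f-positive q (m ∸ suc t)
      local<size x (twoMisses x∉K sx<m) Px =
        proj₁ (proj₂ (classColouring (secondMiss x K) (firstMiss x K))) x (Px , x∉K , refl , refl , sx<m)
      local<size x (oneMiss _ _) _ = s≤s z≤n

      member-twoMisses-nonadjacent : ∀ {x y t} → κ t ≡ x → y ∉ K → secondMiss y K < m →
                                     suc (pred t) ≡ secondMiss y K → ¬ Adj x y
      member-twoMisses-nonadjacent {y = y} {suc t} refl _ sy<m t≡sy x~y =
        Adj⇒¬NonAdj (Adj-sym x~y) (subst (λ l → NonAdj y (κ l)) (sym t≡sy) (NonAdj-secondMiss d y K sy<m))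
      member-twoMisses-nonadjacent {y = y} {zero} refl _ sy<m 1≡sy x~y =
        Adj⇒¬NonAdj (Adj-sym x~y) (subst (λ l → NonAdj y (κ l)) fy≡0 (NonAdj-firstMiss d y K fy<m))
        where
          fy<m = secondMiss<m⇒firstMiss<m sy<m
          fy≡0 : firstMiss y K ≡ 0
          fy≡0 = n<1⇒n≡0 (<-≤-trans (firstMiss<secondMiss y K fy<m) (≤-reflexive (sym 1≡sy)))

      separated : ∀ x y (kx : Kind x) (ky : Kind y) → P x → P y → Adj x y →
                  block x kx ≡ block y ky → local x kx ≢ local y ky
      separated x y (member zero _ refl) (member zero _ refl) _ _ x~y _ _ = Adj⇒≢ x~y refl
      separated x y (member (suc t) t<m refl) (member (suc t') t'<m refl) _ _ x~y bx≡by _ =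
        Adj⇒≢ x~y (cong κ (∸-cancelˡ-≡ (<⇒≤ t<m) (<⇒≤ t'<m) bx≡by))
      separated x y (member t t<m κt≡x) (twoMisses y∉K sy<m) _ _ x~y bx≡by _ =
        member-twoMisses-nonadjacent κt≡x y∉K sy<m
          (∸-cancelˡ-≡ (<⇒≤ (1+pred<m t<m)) (secondMiss≤length y K) bx≡by) x~y
      separated x y (twoMisses x∉K sx<m) (member t t<m κt≡y) _ _ x~y bx≡by _ =
        member-twoMisses-nonadjacent κt≡y x∉K sx<m
          (∸-cancelˡ-≡ (<⇒≤ (1+pred<m t<m)) (secondMiss≤length x K) (sym bx≡by)) (Adj-sym x~y)
      separated x y (member t t<m _) (oneMiss _ _) _ _ _ bx≡0 _ =
        <⇒≢ (m<n⇒0<n∸m (1+pred<m t<m)) (sym bx≡0)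
      separated x y (oneMiss _ _) (member t t<m _) _ _ _ 0≡by _ =
        <⇒≢ (m<n⇒0<n∸m (1+pred<m t<m)) 0≡by
      separated x y (twoMisses _ sx<m) (oneMiss _ _) _ _ _ bx≡0 _ = <⇒≢ (m<n⇒0<n∸m sx<m) (sym bx≡0)
      separated x y (oneMiss _ _) (twoMisses _ sy<m) _ _ _ 0≡by _ = <⇒≢ (m<n⇒0<n∸m sy<m) 0≡by
      separated x y (oneMiss x∉K m≤sx) (oneMiss y∉K m≤sy) Px Py x~y _ _ =
        oneMiss-independent Px Py x∉K y∉K m≤sx m≤sy x~y
      separated x y (twoMisses x∉K sx<m) (twoMisses y∉K sy<m) Px Py x~y bx≡by lx≡ly =
        proj₂ (proj₂ (classColouring (secondMiss x K) (firstMiss x K))) x y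
          (Px , x∉K , refl , refl , sx<m) (Py , y∉K , sym fx≡fy , sym sx≡sy , sx<m) x~y
          (trans lx≡ly (cong₂ (λ i j → proj₁ (classColouring i j) y) (sym sx≡sy) (sym fx≡fy)))
        where
          sx≡sy = ∸-cancelˡ-≡ (secondMiss≤length x K) (secondMiss≤length y K) bx≡by
          fx≡fy = sameSecondMiss⇒sameFirstMiss Px Py x∉K y∉K x~y sx≡sy

      colouring : Colouring P (suc (sumF q m))
      colouring = subst (Colouring P) (blockStart-f q (<-≤-trans (s≤s z≤n) 2≤m))
        (colouring-by-blocks size m (λ x → block x (kind x)) (λ x → local x (kind x))
          (λ x _ → block<m x (kind x)) (λ x → local<size x (kind x))
          (λ x y → separated x y (kind x) (kind y)))

  χ-bound : C₄Free → ∀ p → 2 ≤ p → ∀ k {P} → Decidable P → InducedMatchingFree p P →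
            CliqueBound P k → Colouring P (f p k)
  χ-bound c4-free p 2≤p zero P? _ bound = cliqueBound0⇒colouring0 bound
  χ-bound c4-free p 2≤p (suc zero) P? _ bound = cliqueBound1⇒colouring1 bound
  χ-bound c4-free p 2≤p (suc (suc k)) {P} P? matchingFree bound =
    [ (λ bound′ → colouring-mono (f-mono p k 2≤p) (χ-bound c4-free p 2≤p (suc k) P? matchingFree bound′))
    , maximum
    ] (cliqueBound-attained P? bound)
    where
      maximum : (Σ (List (Fin n)) λ K → length K ≡ 2 + k × IsClique P K) → Colouring P (f p (2 + k))
      maximum (w ∷ K , |K| , K-clique) = colour p 2≤p matchingFree
        where
          open MaximumClique c4-free (w ∷ K) w K-clique (subst (CliqueBound P) (sym |K|) bound)

          colour : ∀ p → 2 ≤ p → InducedMatchingFree p P → Colouring P (f p (2 + k))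
          colour (suc zero) (s≤s ())
          colour (suc (suc zero)) _ 2K₂-free =
            subst (Colouring P ∘ suc) |K| (TwoMatchingFree.colouring 2K₂-free)
          colour (suc (suc (suc q))) _ matchingFree =
            colouring-mono (1+sumF≤f (2 + q) k (s≤s (s≤s z≤n)))
              (subst (Colouring P ∘ suc ∘ sumF (2 + q)) |K|
                (Layered.colouring P? (subst (2 ≤_) (sym |K|) (s≤s (s≤s z≤n))) (2 + q) (s≤s (s≤s z≤n))
                  (λ k → χ-bound c4-free (suc (suc q)) (s≤s (s≤s z≤n)) k) matchingFree))

  Free-C₄⇒C₄Free : Free C₄ G → C₄Free
  Free-C₄⇒C₄Free noC₄ a b c d a~b b~c c~d d~a a≁c b≁d a≢c b≢d =
    noC₄ (φ , (λ {i} {j} → φ-injective i j) , φ-adj)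
    where
      φ : Fin 4 → Fin n
      φ fz = a
      φ (fs fz) = b
      φ (fs (fs fz)) = c
      φ (fs (fs (fs fz))) = d
      φ-adj : ∀ i j → adj G (φ i) (φ j) ≡ adj C₄ i j
      φ-adj fz fz = irrefl G a
      φ-adj fz (fs fz) = a~b
      φ-adj fz (fs (fs fz)) = a≁c
      φ-adj fz (fs (fs (fs fz))) = Adj-sym d~a
      φ-adj (fs fz) fz = Adj-sym a~b
      φ-adj (fs fz) (fs fz) = irrefl G b
      φ-adj (fs fz) (fs (fs fz)) = b~c
      φ-adj (fs fz) (fs (fs (fs fz))) = b≁d
      φ-adj (fs (fs fz)) fz = NonAdj-sym a≁c
      φ-adj (fs (fs fz)) (fs fz) = Adj-sym b~c
      φ-adj (fs (fs fz)) (fs (fs fz)) = irrefl G c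
      φ-adj (fs (fs fz)) (fs (fs (fs fz))) = c~d
      φ-adj (fs (fs (fs fz))) fz = d~a
      φ-adj (fs (fs (fs fz))) (fs fz) = NonAdj-sym b≁d
      φ-adj (fs (fs (fs fz))) (fs (fs fz)) = Adj-sym c~d
      φ-adj (fs (fs (fs fz))) (fs (fs (fs fz))) = irrefl G d
      φ-injective : ∀ i j → φ i ≡ φ j → i ≡ j
      φ-injective fz fz _ = refl
      φ-injective fz (fs fz) a≡b = ⊥-elim (Adj⇒≢ a~b a≡b)
      φ-injective fz (fs (fs fz)) a≡c = ⊥-elim (a≢c a≡c)
      φ-injective fz (fs (fs (fs fz))) a≡d = ⊥-elim (Adj⇒≢ d~a (sym a≡d))
      φ-injective (fs fz) fz b≡a = ⊥-elim (Adj⇒≢ a~b (sym b≡a))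
      φ-injective (fs fz) (fs fz) _ = refl
      φ-injective (fs fz) (fs (fs fz)) b≡c = ⊥-elim (Adj⇒≢ b~c b≡c)
      φ-injective (fs fz) (fs (fs (fs fz))) b≡d = ⊥-elim (b≢d b≡d)
      φ-injective (fs (fs fz)) fz c≡a = ⊥-elim (a≢c (sym c≡a))
      φ-injective (fs (fs fz)) (fs fz) c≡b = ⊥-elim (Adj⇒≢ b~c (sym c≡b))
      φ-injective (fs (fs fz)) (fs (fs fz)) _ = refl
      φ-injective (fs (fs fz)) (fs (fs (fs fz))) c≡d = ⊥-elim (Adj⇒≢ c~d c≡d)
      φ-injective (fs (fs (fs fz))) fz d≡a = ⊥-elim (Adj⇒≢ d~a d≡a)
      φ-injective (fs (fs (fs fz))) (fs fz) d≡b = ⊥-elim (b≢d (sym d≡b))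
      φ-injective (fs (fs (fs fz))) (fs (fs fz)) d≡c = ⊥-elim (Adj⇒≢ c~d (sym d≡c))
      φ-injective (fs (fs (fs fz))) (fs (fs (fs fz))) _ = refl

  endpoint : Fin n → List Edge → ℕ → Fin n
  endpoint d [] t = d
  endpoint d ((x , _) ∷ es) zero = x
  endpoint d ((_ , y) ∷ es) (suc zero) = y
  endpoint d (_ ∷ es) (suc (suc t)) = endpoint d es t

  private
    2+t<2*[1+l] : ∀ {t l} → 2 + t < 2 * suc l → t < 2 * l
    2+t<2*[1+l] {t} {l} lt = ≤-pred (≤-pred (subst (2 + t <_) (*-suc 2 l) lt))

    [2+t]/2 : ∀ t → (2 + t) / 2 ≡ suc (t / 2)
    [2+t]/2 t = m/n≡1+[m∸n]/n {2 + t} {2} (s≤s (s≤s z≤n))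

  NonAdj-endpoint : ∀ {d e es t} → All (Anticomplete e) es → t < 2 * length es →
                    NonAdj (proj₁ e) (endpoint d es t) × NonAdj (proj₂ e) (endpoint d es t)
  NonAdj-endpoint {t = zero} ((x≁u , _ , y≁u , _) ∷ _) _ = x≁u , y≁u
  NonAdj-endpoint {t = suc zero} ((_ , x≁v , _ , y≁v) ∷ _) _ = x≁v , y≁v
  NonAdj-endpoint {t = suc (suc t)} (_ ∷ anti) t<2l = NonAdj-endpoint anti (2+t<2*[1+l] t<2l)

  module _ {d : Fin n} where

    endpoint-adj : ∀ {es} → IsInducedMatching U es → ∀ t t' → t < 2 * length es → t' < 2 * length es →
                   adj G (endpoint d es t) (endpoint d es t') ≡ ((t / 2 ≡ᵇ t' / 2) ∧ not (t ≡ᵇ t'))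
    endpoint-adj (_ ∷ _ , _) zero zero _ _ = irrefl G _
    endpoint-adj ((x~y , _) ∷ _ , _) zero (suc zero) _ _ = x~y
    endpoint-adj ((x~y , _) ∷ _ , _) (suc zero) zero _ _ = Adj-sym x~y
    endpoint-adj (_ ∷ _ , _) (suc zero) (suc zero) _ _ = irrefl G _
    endpoint-adj (_ , anti ∷ _) zero (suc (suc t')) _ t'<2l rewrite [2+t]/2 t' =
      proj₁ (NonAdj-endpoint anti (2+t<2*[1+l] t'<2l))
    endpoint-adj (_ , anti ∷ _) (suc zero) (suc (suc t')) _ t'<2l rewrite [2+t]/2 t' =
      proj₂ (NonAdj-endpoint anti (2+t<2*[1+l] t'<2l))
    endpoint-adj (_ , anti ∷ _) (suc (suc t)) zero t<2l _ rewrite [2+t]/2 t =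
      NonAdj-sym (proj₁ (NonAdj-endpoint anti (2+t<2*[1+l] t<2l)))
    endpoint-adj (_ , anti ∷ _) (suc (suc t)) (suc zero) t<2l _ rewrite [2+t]/2 t =
      NonAdj-sym (proj₂ (NonAdj-endpoint anti (2+t<2*[1+l] t<2l)))
    endpoint-adj (_ ∷ edges , _ ∷ pairs) (suc (suc t)) (suc (suc t')) t<2l t'<2l
      rewrite [2+t]/2 t | [2+t]/2 t' =
      endpoint-adj (edges , pairs) t t' (2+t<2*[1+l] t<2l) (2+t<2*[1+l] t'<2l)

    endpoint-≢ : ∀ {x y es t} → Adj x y → All (Anticomplete (x , y)) es → t < 2 * length es →
                 endpoint d es t ≢ x × endpoint d es t ≢ y
    endpoint-≢ x~y anti t<2l =
      let x≁u , y≁u = NonAdj-endpoint anti t<2l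
      in (λ { refl → Adj⇒¬NonAdj (Adj-sym x~y) y≁u }) , (λ { refl → Adj⇒¬NonAdj x~y x≁u })

    endpoint-injective : ∀ {es} → IsInducedMatching U es → ∀ t t' →
                         t < 2 * length es → t' < 2 * length es → endpoint d es t ≡ endpoint d es t' → t ≡ t'
    endpoint-injective _ zero zero _ _ _ = refl
    endpoint-injective ((x~y , _) ∷ _ , _) zero (suc zero) _ _ x≡y = ⊥-elim (Adj⇒≢ x~y x≡y)
    endpoint-injective ((x~y , _) ∷ _ , _) (suc zero) zero _ _ y≡x = ⊥-elim (Adj⇒≢ x~y (sym y≡x))
    endpoint-injective _ (suc zero) (suc zero) _ _ _ = refl
    endpoint-injective ((x~y , _) ∷ _ , anti ∷ _) zero (suc (suc t')) _ t'<2l x≡u =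
      ⊥-elim (proj₁ (endpoint-≢ x~y anti (2+t<2*[1+l] t'<2l)) (sym x≡u))
    endpoint-injective ((x~y , _) ∷ _ , anti ∷ _) (suc zero) (suc (suc t')) _ t'<2l y≡u =
      ⊥-elim (proj₂ (endpoint-≢ x~y anti (2+t<2*[1+l] t'<2l)) (sym y≡u))
    endpoint-injective ((x~y , _) ∷ _ , anti ∷ _) (suc (suc t)) zero t<2l _ u≡x =
      ⊥-elim (proj₁ (endpoint-≢ x~y anti (2+t<2*[1+l] t<2l)) u≡x)
    endpoint-injective ((x~y , _) ∷ _ , anti ∷ _) (suc (suc t)) (suc zero) t<2l _ u≡y =
      ⊥-elim (proj₂ (endpoint-≢ x~y anti (2+t<2*[1+l] t<2l)) u≡y)
    endpoint-injective (_ ∷ edges , _ ∷ pairs) (suc (suc t)) (suc (suc t')) t<2l t'<2l eq =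
      cong (suc ∘ suc) (endpoint-injective (edges , pairs) t t' (2+t<2*[1+l] t<2l) (2+t<2*[1+l] t'<2l) eq)

  Free-pK₂⇒InducedMatchingFree : ∀ p → Free (pK₂ p) G → InducedMatchingFree p U
  Free-pK₂⇒InducedMatchingFree .0 noMatching [] _ refl = noMatching ((λ ()) , (λ { {()} }) , λ ())
  Free-pK₂⇒InducedMatchingFree p noMatching es@((d , _) ∷ _) matching |es|≡p =
    noMatching ((λ i → endpoint d es (toℕ i)) ,
                (λ {i} {j} eq → toℕ-injective (endpoint-injective matching _ _ (bounded i) (bounded j) eq)) ,
                λ i j → endpoint-adj matching (toℕ i) (toℕ j) (bounded i) (bounded j))
    where
      bounded : ∀ (i : Fin (2 * p)) → toℕ i < 2 * length es
      bounded i = subst (λ l → toℕ i < 2 * l) (sym |es|≡p) (toℕ<n i)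

  Adj-lookup : ∀ {xs} → AllPairs Adj xs → ∀ i j → i ≢ j → Adj (lookup xs i) (lookup xs j)
  Adj-lookup (_ ∷ _) fz fz i≢j = ⊥-elim (i≢j refl)
  Adj-lookup (x~xs ∷ _) fz (fs j) _ = All.lookup x~xs (∈-lookup j)
  Adj-lookup (x~xs ∷ _) (fs i) fz _ = Adj-sym (All.lookup x~xs (∈-lookup i))
  Adj-lookup (_ ∷ pairs) (fs i) (fs j) i≢j = Adj-lookup pairs i j (i≢j ∘ cong fs)

  AllPairs-Adj⇒HasClique : ∀ {xs} → AllPairs Adj xs → HasClique G (length xs)
  AllPairs-Adj⇒HasClique {xs} pairs = lookup xs , (λ {i} {j} → lookup-injective i j) , Adj-lookup pairs
    where
      lookup-injective : ∀ i j → lookup xs i ≡ lookup xs j → i ≡ j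
      lookup-injective i j eq with i Data.Fin.≟ j
      ... | yes i≡j = i≡j
      ... | no i≢j = ⊥-elim (Adj⇒≢ (Adj-lookup pairs i j i≢j) eq)

  Colouring⇒Colourable : ∀ {c} → Colouring U c → Colourable G c
  Colouring⇒Colourable (col , col<c , proper) =
    (λ x → fromℕ< (col<c x _)) ,
    λ x y x~y eq → proper x y _ _ x~y (begin
      col x                     ≡⟨ toℕ-fromℕ< (col<c x _) ⟨
      toℕ (fromℕ< (col<c x _))  ≡⟨ cong toℕ eq ⟩
      toℕ (fromℕ< (col<c y _))  ≡⟨ toℕ-fromℕ< (col<c y _) ⟩
      col y                     ∎)
    where open ≡-Reasoning

theorem3p12 : (p : ℕ) → 2 ≤ p → {n : ℕ} → (G : Graph n) →
    Free (pK₂ p) G → Free C₄ G →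
    (w : ℕ) → IsCliqueNumber G w → Colourable G (f p w)
theorem3p12 p 2≤p G pK₂-free C₄-free w (_ , maximum) =
  Colouring⇒Colourable G (χ-bound G (Free-C₄⇒C₄Free G C₄-free) p 2≤p w U?
    (Free-pK₂⇒InducedMatchingFree G p pK₂-free)
    (λ xs (xs-pairs , _) → maximum (length xs) (AllPairs-Adj⇒HasClique G xs-pairs)))
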